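{- Let $u\in A^*$. Then \[\Big(\sum_{v\in N(u,A)}\mathrm{contr}(u,v)-2\,\mathrm{charge}(u,n(u))\Big)w(n(u))\geq\big(w(N(u,A))-2w(u)\big)w(n(u)).\] Moreover, if $|N(u,A)|\geq 2$, then, writing $R:=N(u,A)\setminus\{n(u),n_2(u)\}$ and $\Delta:=\big(\sum_{v\in N(u,A)}\mathrm{contr}(u,v)-2\,\mathrm{charge}(u,n(u))\big)w(n(u))$: (1) $\Delta\geq(w(u)-w(n(u)))^2+(w(n(u))-w(n_2(u)))\,(w(N(u,A))-w(n(u)))$; (2) $\Delta\geq 2w(u)(w(u)-w(n(u)))+w(n_2(u))(w(n(u))-w(n_2(u)))+w(R)\,(w(n(u))-2w(R))$; (3) $\Delta\geq(w(u)-w(n(u)))^2+\big(w(n(u))-\min\{w(n_2(u)),w(R)\}\big)\,w(R)$.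
   Context: Let $k\geq 4$ be an integer and $G=(V,E)$ a finite simple graph that is $(k+1)$-claw free (no vertex has $k+1$ pairwise non-adjacent neighbors), with weights $w:V\to\mathbb{Q}_{>0}$; for $X\subseteq V$ write $w(X)=\sum_{x\in X}w(x)$ and $w^2(X)=\sum_{x\in X}w(x)^2$. Let $A^*$ be an independent set of maximum weight and $A$ an independent set. For $X\subseteq V$ let $N(X,A)=(X\cap A)\cup\{a\in A:\ a\text{ adjacent to some }x\in X\}$ and $N(u,A)=N(\{u\},A)$. An independent set $X$ is a local improvement of $A$ if $w^2(X)>w^2(N(X,A))$; it is claw-shaped if either $|X|=1$ and $N(X,A)=\emptyset$, or there is $v\in A$ such that $v$ is adjacent to every vertex of $X$ (so $\{v\}\cup X$ induces a star centered at $v$ with leaf set $X$). Assume no claw-shaped improvement of $A$ exists (in particular $A$ is maximal, so $N(u,A)\neq\emptyset$ for all $u$). Fix $n:V\to A$ with $n(u)$ a vertex of maximum weight in $N(u,A)$, and $n_2$ on $\{u:|N(u,A)|\geq 2\}$ with $n_2(u)$ a vertex of maximum weight in $N(u,A)\setminus\{n(u)\}$. For $u\in V$, $v\in A$: $\mathrm{contr}(u,v)=\max\{0,(w(u)^2-w^2(N(u,A)\setminus\{v\}))/w(v)\}$ if $v\in N(u,A)$ and $0$ otherwise; $\mathrm{charge}(u,v)=w(u)-\tfrac12 w(N(u,A))$ if $v=n(u)$ and $0$ otherwise. -}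

module Defs where

open import Data.Nat using (ℕ; zero; suc)
open import Data.Bool using (Bool; true; false; T; _∧_; _∨_; if_then_else_)
open import Data.Fin using (Fin; zero; suc)
open import Data.Fin.Subset using (Subset; _∈_; ∣_∣; Empty)
open import Data.Vec using (Vec; []; _∷_; tabulate; lookup)
open import Data.Product using (_×_; ∃; ∃-syntax)
open import Data.Sum using (_⊎_)
open import Data.Empty using (⊥)
open import Relation.Nullary using (¬_; yes; no)
open import Relation.Binary.PropositionalEquality using (_≡_; _≢_)
open import Data.Rational using (ℚ; 0ℚ; _+_; _*_; _-_; _÷_; _⊔_; ½; _≤_; _<_; Positive)
open import Data.Rational.Properties using (pos⇒nonZero)
import Data.Fin as F

Adjacency : ℕ → Set
Adjacency m = Fin m → Fin m → Bool

SimpleGraph : {m : ℕ} → Adjacency m → Set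
SimpleGraph {m} adj = (∀ x y → adj x y ≡ adj y x) × (∀ x → adj x x ≡ false)

Independent : {m : ℕ} → Adjacency m → Subset m → Set
Independent adj X = ∀ x y → x ∈ X → y ∈ X → ¬ T (adj x y)

-- (k+1)-claw free: no vertex has k+1 pairwise non-adjacent neighbours
ClawFree : {m : ℕ} → ℕ → Adjacency m → Set
ClawFree {m} k adj = ∀ (v : Fin m) (S : Subset m) →
  ∣ S ∣ ≡ suc k → (∀ x → x ∈ S → T (adj v x)) → ¬ Independent adj S

sumOver : {m : ℕ} → (Fin m → ℚ) → Subset m → ℚ
sumOver {zero} f [] = 0ℚ
sumOver {suc m} f (b ∷ bs) = (if b then f zero else 0ℚ) + sumOver (λ i → f (suc i)) bs

sumSq : {m : ℕ} → (Fin m → ℚ) → Subset m → ℚ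
sumSq w X = sumOver (λ x → w x * w x) X

anyIn : {m : ℕ} → Subset m → (Fin m → Bool) → Bool
anyIn {zero} [] p = false
anyIn {suc m} (b ∷ bs) p = (b ∧ p zero) ∨ anyIn bs (λ i → p (suc i))

anyAdj : {m : ℕ} → Adjacency m → Subset m → Fin m → Bool
anyAdj adj X a = anyIn X (λ x → adj x a)

N : {m : ℕ} → Adjacency m → Subset m → Subset m → Subset m
N adj X A = tabulate (λ a → lookup A a ∧ (lookup X a ∨ anyAdj adj X a))

Nv : {m : ℕ} → Adjacency m → Fin m → Subset m → Subset m
Nv adj u A = N adj (Data.Fin.Subset.⁅ u ⁆) A

ClawShaped : {m : ℕ} → Adjacency m → Subset m → Subset m → Set
ClawShaped adj A X =
  (∣ X ∣ ≡ 1 × Empty (N adj X A)) ⊎ (∃[ v ] (v ∈ A × (∀ x → x ∈ X → T (adj v x))))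

LocalImprovement : {m : ℕ} → Adjacency m → (Fin m → ℚ) → Subset m → Subset m → Set
LocalImprovement adj w A X = Independent adj X × sumSq w (N adj X A) < sumSq w X

MaxWeightIndependent : {m : ℕ} → Adjacency m → (Fin m → ℚ) → Subset m → Set
MaxWeightIndependent adj w A* =
  Independent adj A* × (∀ I → Independent adj I → sumOver w I ≤ sumOver w A*)

IsN : {m : ℕ} → Adjacency m → (Fin m → ℚ) → Subset m → (Fin m → Fin m) → Set
IsN adj w A n = ∀ u → n u ∈ Nv adj u A × (∀ a → a ∈ Nv adj u A → w a ≤ w (n u))

IsN₂ : {m : ℕ} → Adjacency m → (Fin m → ℚ) → Subset m → (Fin m → Fin m) → (Fin m → Fin m) → Set
IsN₂ adj w A n n₂ = ∀ u → 2 Data.Nat.≤ ∣ Nv adj u A ∣ →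
  n₂ u ∈ Nv adj u A × n₂ u ≢ n u × (∀ a → a ∈ Nv adj u A → a ≢ n u → w a ≤ w (n₂ u))

contr : {m : ℕ} → Adjacency m → (w : Fin m → ℚ) → (∀ x → Positive (w x)) →
        Subset m → Fin m → Fin m → ℚ
contr adj w pos A u v with lookup (Nv adj u A) v
... | false = 0ℚ
... | true  = 0ℚ ⊔ (_÷_ (w u * w u - sumSq w (Nv adj u A Data.Fin.Subset.- v)) (w v)
                      {{pos⇒nonZero (w v) {{pos v}}}})

charge : {m : ℕ} → Adjacency m → (Fin m → ℚ) → Subset m → (Fin m → Fin m) →
         Fin m → Fin m → ℚ
charge adj w A n u v with v F.≟ n u
... | yes _ = w u - ½ * sumOver w (Nv adj u A)
... | no _  = 0ℚ

{-# OPTIONS --safe #-}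
-- Splitting N(u,A) into n(u), n₂(u) and the rest R, the definition of
-- contr gives
--   contr(u,n(u))·w(n(u))   ≥ w(u)² − w(n₂(u))² − w²(R),
--   contr(u,n₂(u))·w(n₂(u)) ≥ w(u)² − w(n(u))² − w²(R),
-- while 2·charge(u,n(u)) = 2w(u) − w(N(u,A)). Substituting the first estimate
-- into Δ leaves Δ ≥ (w(u) − w(n(u)))² + w(n₂(u))(w(n(u)) − w(n₂(u)))
-- + w(n(u))·w(R) − w²(R), and the three bounds follow from w²(R) ≤ c·w(R)
-- with c = w(n₂(u)), w(R) and min{w(n₂(u)), w(R)} respectively, since every
-- vertex of R weighs at most w(n₂(u)) and at most w(R); the second bound also
-- spends the estimate for contr(u,n₂(u)).
module Submission where

open import Defs
open import Data.Nat using (ℕ; _≤_)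
open import Data.Fin using (Fin)
open import Data.Fin.Subset using (Subset; _∈_; ∣_∣; _-_)
open import Data.Product using (_×_)
open import Data.Rational using (ℚ; _+_; _*_; _⊓_; Positive) renaming (_≤_ to _≤ℚ_; _-_ to _−_)
open import Relation.Nullary using (¬_)

open import Level using (0ℓ)
open import Function using (_∘_)
open import Data.Nat using (zero; suc)
open import Data.Bool using (true; false; if_then_else_)
open import Data.Fin using (zero; suc)
open import Data.Fin.Subset using (_─_; _∉_; ⁅_⁆; inside; outside)
open import Data.Fin.Subset.Properties
  using (p─⊥≡p; p─q⊆p; p─x─y≡p─y─x; x∉⁅y⁆⇒x≢y; x∈p∧x≢y⇒x∈p-y)
open import Data.Vec using ([]; _∷_; lookup)
open import Data.Vec.Base using (here; there)
open import Data.Vec.Properties using ([]=⇒lookup)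
open import Data.Product using (_,_; proj₁; proj₂)
open import Data.Rational using (0ℚ; 1ℚ; ½; -_; _⊔_; _÷_; 1/_; NonZero; nonNegative)
open import Data.Rational.Properties
  using (_≟_; +-*-commutativeRing; ≤-refl; ≤-trans; <⇒≤; +-mono-≤; +-monoʳ-≤; +-monoˡ-≤; +-identityˡ; +-identityʳ;
         *-zeroʳ; *-distribˡ-+; *-assoc; *-inverseˡ; *-identityʳ; *-monoʳ-≤-nonNeg; *-monoˡ-≤-nonNeg;
         ≤-reflexive; nonNegative⁻¹; nonNeg*nonNeg⇒nonNeg; positive⁻¹;
         pos⇒nonZero; p≤p⊔q; p≤q⊔p; ⊓-glb; module ≤-Reasoning)
import Data.Fin as F
open import Relation.Nullary using (yes; no; contradiction)
open import Relation.Nullary.Decidable using (dec⇒maybe)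
open import Relation.Binary.PropositionalEquality
  using (_≡_; _≢_; refl; sym; trans; cong; subst; module ≡-Reasoning)
open import Tactic.RingSolver using (solve-∀)
import Tactic.RingSolver.Core.AlmostCommutativeRing as ACR

ℚ-ring : ACR.AlmostCommutativeRing 0ℓ 0ℓ
ℚ-ring = ACR.fromCommutativeRing +-*-commutativeRing (λ x → dec⇒maybe (0ℚ ≟ x))

0≤p*q : ∀ {p q} → 0ℚ ≤ℚ p → 0ℚ ≤ℚ q → 0ℚ ≤ℚ p * q
0≤p*q {p} {q} 0≤p 0≤q =
  nonNegative⁻¹ (p * q) {{nonNeg*nonNeg⇒nonNeg p {{nonNegative 0≤p}} q {{nonNegative 0≤q}}}}

*-monoʳ-≤-0≤ : ∀ {r p q} → 0ℚ ≤ℚ r → p ≤ℚ q → p * r ≤ℚ q * r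
*-monoʳ-≤-0≤ {r} 0≤r = *-monoʳ-≤-nonNeg r {{nonNegative 0≤r}}

*-monoˡ-≤-0≤ : ∀ {r p q} → 0ℚ ≤ℚ r → p ≤ℚ q → r * p ≤ℚ r * q
*-monoˡ-≤-0≤ {r} 0≤r = *-monoˡ-≤-nonNeg r {{nonNegative 0≤r}}

p≤q⇒0≤q−p : ∀ {p q} → p ≤ℚ q → 0ℚ ≤ℚ q − p
p≤q⇒0≤q−p {p} {q} p≤q = begin
  0ℚ      ≡⟨ p−p≡0 p ⟨
  p − p   ≤⟨ +-monoˡ-≤ (- p) p≤q ⟩
  q − p   ∎
  where
  open ≤-Reasoning
  p−p≡0 : ∀ p → p − p ≡ 0ℚ
  p−p≡0 = solve-∀ ℚ-ring

p≤p+q : ∀ p {q} → 0ℚ ≤ℚ q → p ≤ℚ p + q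
p≤p+q p {q} 0≤q = begin
  p        ≡⟨ +-identityʳ p ⟨
  p + 0ℚ   ≤⟨ +-monoʳ-≤ p 0≤q ⟩
  p + q    ∎
  where open ≤-Reasoning

p−q≤p : ∀ p {q} → 0ℚ ≤ℚ q → p − q ≤ℚ p
p−q≤p p {q} 0≤q = begin
  p − q    ≤⟨ p≤p+q (p − q) 0≤q ⟩
  p − q + q ≡⟨ p−q+q≡p p q ⟩
  p        ∎
  where
  open ≤-Reasoning
  p−q+q≡p : ∀ p q → p − q + q ≡ p
  p−q+q≡p = solve-∀ ℚ-ring

÷-*-cancel : ∀ p q .{{_ : NonZero q}} → (p ÷ q) * q ≡ p
÷-*-cancel p q = begin
  p * (1/ q) * q     ≡⟨ *-assoc p (1/ q) q ⟩
  p * ((1/ q) * q)   ≡⟨ cong (p *_) (*-inverseˡ q) ⟩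
  p * 1ℚ             ≡⟨ *-identityʳ p ⟩
  p                  ∎
  where open ≡-Reasoning

x∈p─q⇒x∉q : ∀ {m} {x : Fin m} (p q : Subset m) → x ∈ p ─ q → x ∉ q
x∈p─q⇒x∉q (_ ∷ p) (outside ∷ q) here        ()
x∈p─q⇒x∉q (_ ∷ p) (_ ∷ q)       (there x∈) (there x∈q) = x∈p─q⇒x∉q p q x∈ x∈q

x∈p-y⇒x≢y : ∀ {m} {x y : Fin m} (p : Subset m) → x ∈ p - y → x ≢ y
x∈p-y⇒x≢y {y = y} p x∈ = x∉⁅y⁆⇒x≢y (x∈p─q⇒x∉q p ⁅ y ⁆ x∈)

x∈p-y⇒x∈p : ∀ {m} {x y : Fin m} (p : Subset m) → x ∈ p - y → x ∈ p
x∈p-y⇒x∈p {y = y} p = p─q⊆p p ⁅ y ⁆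

sumOver-nonneg : ∀ {m} (f : Fin m → ℚ) (X : Subset m) → (∀ x → x ∈ X → 0ℚ ≤ℚ f x) →
  0ℚ ≤ℚ sumOver f X
sumOver-nonneg {zero}  f []            0≤f = ≤-refl
sumOver-nonneg {suc m} f (inside ∷ X)  0≤f =
  +-mono-≤ (0≤f zero here) (sumOver-nonneg _ X (λ x x∈ → 0≤f (suc x) (there x∈)))
sumOver-nonneg {suc m} f (outside ∷ X) 0≤f =
  +-mono-≤ ≤-refl (sumOver-nonneg _ X (λ x x∈ → 0≤f (suc x) (there x∈)))

sumOver-remove : ∀ {m} (f : Fin m → ℚ) (X : Subset m) {v : Fin m} → v ∈ X →
  sumOver f X ≡ f v + sumOver f (X - v)
sumOver-remove {suc m} f (inside ∷ X) here =
  cong (f zero +_) (trans (cong (sumOver (f ∘ suc)) (sym (p─⊥≡p X))) (sym (+-identityˡ _)))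
sumOver-remove {suc m} f (b ∷ X) {suc v} (there v∈X) = begin
  c + sumOver (f ∘ suc) X                     ≡⟨ cong (c +_) (sumOver-remove (f ∘ suc) X v∈X) ⟩
  c + (f (suc v) + sumOver (f ∘ suc) (X - v)) ≡⟨ swap c (f (suc v)) _ ⟩
  f (suc v) + (c + sumOver (f ∘ suc) (X - v)) ∎
  where
  open ≡-Reasoning
  c : ℚ
  c = if b then f zero else 0ℚ
  swap : ∀ x y z → x + (y + z) ≡ y + (x + z)
  swap = solve-∀ ℚ-ring

sumOver-remove₂ : ∀ {m} (f : Fin m → ℚ) (X : Subset m) {x y : Fin m} → x ∈ X → y ∈ X - x →
  sumOver f X ≡ f x + (f y + sumOver f (X - x - y))
sumOver-remove₂ f X {x} x∈X y∈X-x =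
  trans (sumOver-remove f X x∈X) (cong (f x +_) (sumOver-remove f (X - x) y∈X-x))

∈⇒≤-sumOver : ∀ {m} (f : Fin m → ℚ) (X : Subset m) {v : Fin m} → v ∈ X →
  (∀ x → x ∈ X → 0ℚ ≤ℚ f x) → f v ≤ℚ sumOver f X
∈⇒≤-sumOver f X {v} v∈X 0≤f = begin
  f v                       ≤⟨ p≤p+q (f v) (sumOver-nonneg f (X - v) (λ x x∈ → 0≤f x (x∈p-y⇒x∈p X x∈))) ⟩
  f v + sumOver f (X - v)   ≡⟨ sumOver-remove f X v∈X ⟨
  sumOver f X               ∎
  where open ≤-Reasoning

sumOver-≤-* : ∀ {m} (f g : Fin m → ℚ) (c : ℚ) (X : Subset m) →
  (∀ x → x ∈ X → f x ≤ℚ c * g x) → sumOver f X ≤ℚ c * sumOver g X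
sumOver-≤-* {zero}  f g c []            f≤cg = ≤-reflexive (sym (*-zeroʳ c))
sumOver-≤-* {suc m} f g c (inside ∷ X)  f≤cg = begin
  f zero + sumOver (f ∘ suc) X           ≤⟨ +-mono-≤ (f≤cg zero here) (sumOver-≤-* _ _ c X (λ x x∈ → f≤cg (suc x) (there x∈))) ⟩
  c * g zero + c * sumOver (g ∘ suc) X   ≡⟨ *-distribˡ-+ c (g zero) _ ⟨
  c * (g zero + sumOver (g ∘ suc) X)     ∎
  where open ≤-Reasoning
sumOver-≤-* {suc m} f g c (outside ∷ X) f≤cg = begin
  0ℚ + sumOver (f ∘ suc) X         ≤⟨ +-monoʳ-≤ 0ℚ (sumOver-≤-* _ _ c X (λ x x∈ → f≤cg (suc x) (there x∈))) ⟩
  0ℚ + c * sumOver (g ∘ suc) X     ≡⟨ identity c (sumOver (g ∘ suc) X) ⟩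
  c * (0ℚ + sumOver (g ∘ suc) X)   ∎
  where
  open ≤-Reasoning
  identity : ∀ c s → 0ℚ + c * s ≡ c * (0ℚ + s)
  identity = solve-∀ ℚ-ring

sumSq-≤-*sumOver : ∀ {m} (w : Fin m → ℚ) (c : ℚ) (X : Subset m) →
  (∀ x → x ∈ X → 0ℚ ≤ℚ w x × w x ≤ℚ c) → sumSq w X ≤ℚ c * sumOver w X
sumSq-≤-*sumOver w c X bounded =
  sumOver-≤-* (λ x → w x * w x) w c X (λ x x∈ → *-monoʳ-≤-0≤ (proj₁ (bounded x x∈)) (proj₂ (bounded x x∈)))

module _ {m : ℕ} (adj : Adjacency m) (w : Fin m → ℚ) (pos : ∀ x → Positive (w x))
         (A : Subset m) (u : Fin m) where

  private
    instance
      w-nonZero : ∀ {v} → NonZero (w v)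
      w-nonZero {v} = pos⇒nonZero (w v) {{pos v}}

    gain : Fin m → ℚ
    gain v = w u * w u − sumSq w (Nv adj u A - v)

  contr-nonneg : ∀ v → 0ℚ ≤ℚ contr adj w pos A u v
  contr-nonneg v with lookup (Nv adj u A) v
  ... | false = ≤-refl
  ... | true  = p≤p⊔q 0ℚ (gain v ÷ w v)

  contr-*-≥ : ∀ {v} → v ∈ Nv adj u A →
    w u * w u − sumSq w (Nv adj u A - v) ≤ℚ contr adj w pos A u v * w v
  contr-*-≥ {v} v∈N with lookup (Nv adj u A) v | []=⇒lookup v∈N
  ... | true | _ = begin
    gain v                      ≡⟨ ÷-*-cancel (gain v) (w v) ⟨
    (gain v ÷ w v) * w v        ≤⟨ *-monoʳ-≤-0≤ (<⇒≤ (positive⁻¹ (w v) {{pos v}})) (p≤q⊔p 0ℚ (gain v ÷ w v)) ⟩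
    (0ℚ ⊔ gain v ÷ w v) * w v   ∎
    where open ≤-Reasoning

charge-n+charge-n : ∀ {m} (adj : Adjacency m) (w : Fin m → ℚ) (A : Subset m) (n : Fin m → Fin m) u →
  let ch = charge adj w A n u (n u) in ch + ch ≡ (w u + w u) − sumOver w (Nv adj u A)
charge-n+charge-n adj w A n u with n u F.≟ n u
... | yes _ = identity (w u) (sumOver w (Nv adj u A))
  where
  identity : ∀ x W → (x − ½ * W) + (x − ½ * W) ≡ (x + x) − W
  identity = solve-∀ ℚ-ring
... | no n≢n = contradiction refl n≢n

module TwoNeighbours {m : ℕ} (adj : Adjacency m) (w : Fin m → ℚ) (pos : ∀ x → Positive (w x))
                     (A : Subset m) (u x y : Fin m)
                     (x∈N : x ∈ Nv adj u A) (y∈N : y ∈ Nv adj u A) (y≢x : y ≢ x) where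

  N-u : Subset m
  N-u = Nv adj u A

  R : Subset m
  R = N-u - x - y

  y∈N-x : y ∈ N-u - x
  y∈N-x = x∈p∧x≢y⇒x∈p-y y∈N y≢x

  x∈N-y : x ∈ N-u - y
  x∈N-y = x∈p∧x≢y⇒x∈p-y x∈N (y≢x ∘ sym)

  sumOver-N : ∀ f → sumOver f N-u ≡ f x + (f y + sumOver f R)
  sumOver-N f = sumOver-remove₂ f N-u x∈N y∈N-x

  contr-x : w u * w u − (w y * w y + sumSq w R) ≤ℚ contr adj w pos A u x * w x
  contr-x = subst (λ s → w u * w u − s ≤ℚ _) (sumOver-remove _ (N-u - x) y∈N-x)
              (contr-*-≥ adj w pos A u x∈N)

  contr-y : w u * w u − (w x * w x + sumSq w R) ≤ℚ contr adj w pos A u y * w y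
  contr-y = subst (λ s → w u * w u − s ≤ℚ _) sumSq-N-y (contr-*-≥ adj w pos A u y∈N)
    where
    sumSq-N-y : sumSq w (N-u - y) ≡ w x * w x + sumSq w R
    sumSq-N-y = trans (sumOver-remove _ (N-u - y) x∈N-y)
                      (cong (λ X → w x * w x + sumSq w X) (p─x─y≡p─y─x N-u y x))

  ∈R⇒∈N-x : ∀ {z} → z ∈ R → z ∈ N-u × z ≢ x
  ∈R⇒∈N-x z∈R = x∈p-y⇒x∈p N-u z∈N-x , x∈p-y⇒x≢y N-u z∈N-x
    where z∈N-x = x∈p-y⇒x∈p (N-u - x) z∈R

Δ₀-bound : ∀ wu W {a S Ch} → Ch ≡ (wu + wu) − W → 0ℚ ≤ℚ S → 0ℚ ≤ℚ a →
  (W − (wu + wu)) * a ≤ℚ (S − Ch) * a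
Δ₀-bound wu W {a} {S} refl 0≤S 0≤a = begin
  (W − (wu + wu)) * a                ≤⟨ p≤p+q _ (0≤p*q 0≤S 0≤a) ⟩
  (W − (wu + wu)) * a + S * a        ≡⟨ identity wu a W S ⟩
  (S − ((wu + wu) − W)) * a          ∎
  where
  open ≤-Reasoning
  identity : ∀ wu a W S → (W − (wu + wu)) * a + S * a ≡ (S − ((wu + wu) − W)) * a
  identity = solve-∀ ℚ-ring

-- a = w(n(u)), b = w(n₂(u)), r = w(R), q = w²(R), W = w(N(u,A)), S = Σ contr(u,·),
-- Ch = 2·charge(u,n(u)), Cn = contr(u,n(u)), Cb = contr(u,n₂(u)), d = Σ_R contr(u,·).
module Δ-bounds (wu a b r q W S Ch Cn Cb d : ℚ)
  (W≡ : W ≡ a + (b + r)) (Ch≡ : Ch ≡ (wu + wu) − W) (S≡ : S ≡ Cn + (Cb + d))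
  (0≤a : 0ℚ ≤ℚ a) (0≤b : 0ℚ ≤ℚ b) (b≤a : b ≤ℚ a) (0≤Cb : 0ℚ ≤ℚ Cb) (0≤d : 0ℚ ≤ℚ d)
  (contr-n : wu * wu − (b * b + q) ≤ℚ Cn * a)
  (contr-n₂ : wu * wu − (a * a + q) ≤ℚ Cb * b) where

  Δ : ℚ
  Δ = (S − Ch) * a

  core : ℚ
  core = (wu − a) * (wu − a) + b * (a − b) + (a * r − q)

  Δ-split : Δ ≡ (Cn * a − (wu * wu − (b * b + q))) + core + (Cb + d) * a
  Δ-split rewrite S≡ | Ch≡ | W≡ = identity wu a b r q Cn Cb d
    where
    identity : ∀ wu a b r q Cn Cb d →
      (Cn + (Cb + d) − ((wu + wu) − (a + (b + r)))) * a ≡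
      (Cn * a − (wu * wu − (b * b + q))) + ((wu − a) * (wu − a) + b * (a − b) + (a * r − q)) + (Cb + d) * a
    identity = solve-∀ ℚ-ring

  core+≤Δ : core + (Cb + d) * a ≤ℚ Δ
  core+≤Δ = begin
    core + (Cb + d) * a                                        ≡⟨ cong (_+ (Cb + d) * a) (+-identityˡ core) ⟨
    0ℚ + core + (Cb + d) * a                                   ≤⟨ +-monoˡ-≤ _ (+-monoˡ-≤ core (p≤q⇒0≤q−p contr-n)) ⟩
    (Cn * a − (wu * wu − (b * b + q))) + core + (Cb + d) * a   ≡⟨ Δ-split ⟨
    Δ                                                          ∎
    where open ≤-Reasoning

  core≤Δ : core ≤ℚ Δ
  core≤Δ = ≤-trans (p≤p+q core (0≤p*q (+-mono-≤ 0≤Cb 0≤d) 0≤a)) core+≤Δ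

  core+contr-n₂≤Δ : core + (wu * wu − (a * a + q)) ≤ℚ Δ
  core+contr-n₂≤Δ = begin
    core + (wu * wu − (a * a + q))   ≤⟨ +-monoʳ-≤ core contr-n₂ ⟩
    core + Cb * b                    ≤⟨ +-monoʳ-≤ core (*-monoˡ-≤-0≤ 0≤Cb b≤a) ⟩
    core + Cb * a                    ≤⟨ +-monoʳ-≤ core (*-monoʳ-≤-0≤ 0≤a (p≤p+q Cb 0≤d)) ⟩
    core + (Cb + d) * a              ≤⟨ core+≤Δ ⟩
    Δ                                ∎
    where open ≤-Reasoning

  bound₁ : q ≤ℚ b * r → (wu − a) * (wu − a) + (a − b) * (W − a) ≤ℚ Δ
  bound₁ q≤br = begin
    (wu − a) * (wu − a) + (a − b) * (W − a)              ≡⟨ cong (λ t → (wu − a) * (wu − a) + (a − b) * (t − a)) W≡ ⟩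
    (wu − a) * (wu − a) + (a − b) * (a + (b + r) − a)    ≡⟨ identity wu a b r q ⟩
    core − (b * r − q)                                   ≤⟨ p−q≤p core (p≤q⇒0≤q−p q≤br) ⟩
    core                                                 ≤⟨ core≤Δ ⟩
    Δ                                                    ∎
    where
    open ≤-Reasoning
    identity : ∀ wu a b r q → (wu − a) * (wu − a) + (a − b) * (a + (b + r) − a) ≡
      (wu − a) * (wu − a) + b * (a − b) + (a * r − q) − (b * r − q)
    identity = solve-∀ ℚ-ring

  bound₂ : q ≤ℚ r * r → (wu + wu) * (wu − a) + b * (a − b) + r * (a − (r + r)) ≤ℚ Δ
  bound₂ q≤rr = begin
    (wu + wu) * (wu − a) + b * (a − b) + r * (a − (r + r))         ≡⟨ identity wu a b r q ⟩
    core + (wu * wu − (a * a + q)) − ((r * r − q) + (r * r − q))   ≤⟨ p−q≤p _ (+-mono-≤ 0≤rr−q 0≤rr−q) ⟩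
    core + (wu * wu − (a * a + q))                                 ≤⟨ core+contr-n₂≤Δ ⟩
    Δ                                                              ∎
    where
    open ≤-Reasoning
    0≤rr−q : 0ℚ ≤ℚ r * r − q
    0≤rr−q = p≤q⇒0≤q−p q≤rr
    identity : ∀ wu a b r q → (wu + wu) * (wu − a) + b * (a − b) + r * (a − (r + r)) ≡
      (wu − a) * (wu − a) + b * (a − b) + (a * r − q) + (wu * wu − (a * a + q)) − ((r * r − q) + (r * r − q))
    identity = solve-∀ ℚ-ring

  bound₃ : q ≤ℚ (b ⊓ r) * r → (wu − a) * (wu − a) + (a − (b ⊓ r)) * r ≤ℚ Δ
  bound₃ q≤mr = begin
    (wu − a) * (wu − a) + (a − (b ⊓ r)) * r                ≡⟨ identity wu a b r q (b ⊓ r) ⟩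
    core − (b * (a − b) + ((b ⊓ r) * r − q))               ≤⟨ p−q≤p core (+-mono-≤ (0≤p*q 0≤b (p≤q⇒0≤q−p b≤a)) (p≤q⇒0≤q−p q≤mr)) ⟩
    core                                                   ≤⟨ core≤Δ ⟩
    Δ                                                      ∎
    where
    open ≤-Reasoning
    identity : ∀ wu a b r q m → (wu − a) * (wu − a) + (a − m) * r ≡
      (wu − a) * (wu − a) + b * (a − b) + (a * r − q) − (b * (a − b) + (m * r − q))
    identity = solve-∀ ℚ-ring

lemma9 : (k : ℕ) → 4 ≤ k → (m : ℕ) → (adj : Adjacency m) → SimpleGraph adj →
  ClawFree k adj →
  (w : Fin m → ℚ) → (pos : ∀ x → Positive (w x)) →
  (A* A : Subset m) → MaxWeightIndependent adj w A* → Independent adj A →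
  (∀ X → ClawShaped adj A X → ¬ LocalImprovement adj w A X) →
  (n n₂ : Fin m → Fin m) → IsN adj w A n → IsN₂ adj w A n n₂ →
  (u : Fin m) → u ∈ A* →
  let NA = Nv adj u A
      wu = w u
      wn = w (n u)
      wn₂ = w (n₂ u)
      wN = sumOver w NA
      wR = sumOver w ((NA - n u) - n₂ u)
      ch = charge adj w A n u (n u)
      Δ = (sumOver (contr adj w pos A u) NA − (ch + ch)) * wn
  in ((wN − (wu + wu)) * wn ≤ℚ Δ)
     × (2 ≤ ∣ NA ∣ →
         (((wu − wn) * (wu − wn) + (wn − wn₂) * (wN − wn)) ≤ℚ Δ)
         × (((wu + wu) * (wu − wn) + wn₂ * (wn − wn₂) + wR * (wn − (wR + wR))) ≤ℚ Δ)
         × (((wu − wn) * (wu − wn) + (wn − (wn₂ ⊓ wR)) * wR) ≤ℚ Δ))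
lemma9 _ _ m adj _ _ w pos _ A _ _ _ n n₂ isN isN₂ u _ =
  Δ₀-bound (w u) (sumOver w (Nv adj u A)) (charge-n+charge-n adj w A n u)
           (0≤sumOver-contr (Nv adj u A)) (0≤w (n u)) ,
  λ two → let open Bounds two in
    bound₁ (R-sumSq≤ w₂-max) , bound₂ (R-sumSq≤ R-max) , bound₃ (R-sumSq≤ λ z∈ → ⊓-glb (w₂-max z∈) (R-max z∈))
  where
  0≤w : ∀ x → 0ℚ ≤ℚ w x
  0≤w x = <⇒≤ (positive⁻¹ (w x) {{pos x}})

  0≤sumOver-contr : ∀ X → 0ℚ ≤ℚ sumOver (contr adj w pos A u) X
  0≤sumOver-contr X = sumOver-nonneg _ X (λ v _ → contr-nonneg adj w pos A u v)

  module Bounds (two : 2 ≤ ∣ Nv adj u A ∣) where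
    open TwoNeighbours adj w pos A u (n u) (n₂ u) (proj₁ (isN u)) (proj₁ (isN₂ u two)) (proj₁ (proj₂ (isN₂ u two)))
    open Δ-bounds (w u) (w (n u)) (w (n₂ u)) (sumOver w R) (sumSq w R) (sumOver w N-u)
                  (sumOver (contr adj w pos A u) N-u) _ (contr adj w pos A u (n u)) (contr adj w pos A u (n₂ u))
                  (sumOver (contr adj w pos A u) R)
                  (sumOver-N w) (charge-n+charge-n adj w A n u) (sumOver-N (contr adj w pos A u))
                  (0≤w (n u)) (0≤w (n₂ u)) (proj₂ (isN u) (n₂ u) (proj₁ (isN₂ u two)))
                  (contr-nonneg adj w pos A u (n₂ u)) (0≤sumOver-contr R) contr-x contr-y public

    w₂-max : ∀ {z} → z ∈ R → w z ≤ℚ w (n₂ u)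
    w₂-max z∈R = proj₂ (proj₂ (isN₂ u two)) _ (proj₁ (∈R⇒∈N-x z∈R)) (proj₂ (∈R⇒∈N-x z∈R))

    R-max : ∀ {z} → z ∈ R → w z ≤ℚ sumOver w R
    R-max z∈R = ∈⇒≤-sumOver w R z∈R (λ x _ → 0≤w x)

    R-sumSq≤ : ∀ {c} → (∀ {z} → z ∈ R → w z ≤ℚ c) → sumSq w R ≤ℚ c * sumOver w R
    R-sumSq≤ {c} ≤c = sumSq-≤-*sumOver w c R (λ z z∈R → 0≤w z , ≤c z∈R)
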